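{- Let $\Gamma=\langle\alpha_1,\ldots,\alpha_k\rangle\subset\mathbb N^d$ be an affine semigroup and fix $i\le k$. Then $$\mathsf t_i(\Gamma)=\sup\{\mathsf t_i(\gamma):\gamma\in M_i\},$$ where $M_i=\{\varphi_\Gamma(x): x\in\mathrm{Minimals}_\le\mathsf Z(\alpha_i+\Gamma)\}$.
   Context: An affine semigroup is a finitely generated submonoid of $\mathbb N^d$ with minimal generating set $\alpha_1,\ldots,\alpha_k$; $\varphi_\Gamma(z)=z_1\alpha_1+\cdots+z_k\alpha_k$ for $z\in\mathbb N^k$, $\mathsf Z(\gamma)=\varphi_\Gamma^{ -1}(\gamma)$, $|z|=z_1+\cdots+z_k$. For $z,w\in\mathbb N^k$, $\gcd(z,w)=(\min(z_l,w_l))_l$ and $\mathrm{dist}(z,w)=\max(|z-\gcd(z,w)|,|w-\gcd(z,w)|)$. For $\gamma\in\Gamma$ with $\gamma-\alpha_i\in\Gamma$, $\mathsf t_i(\gamma)$ is the least $N\in\mathbb N\cup\{\infty\}$ such that for every $z\in\mathsf Z(\gamma)$ there is $w\in\mathsf Z(\gamma)$ with $w_i>0$ and $\mathrm{dist}(z,w)\le N$; and $\mathsf t_i(\Gamma)=\sup\{\mathsf t_i(\gamma):\gamma-\alpha_i\in\Gamma\}$. $\alpha_i+\Gamma=\{\alpha_i+\beta:\beta\in\Gamma\}$, $\mathsf Z(\alpha_i+\Gamma)=\bigcup_{\gamma\in\alpha_i+\Gamma}\mathsf Z(\gamma)$, and $\mathrm{Minimals}_\le$ denotes the set of minimal elements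 with respect to the componentwise partial order $\le$ on $\mathbb N^k$. -}

module Defs where

open import Data.Nat using (ℕ; zero; suc; _+_; _*_; _∸_; _≤_; _<_; _⊔_; _⊓_)
open import Data.Fin using (Fin; zero; suc)
open import Data.Product using (Σ; ∃; _×_; _,_)
open import Data.Unit using (⊤)
open import Relation.Binary.PropositionalEquality using (_≡_)
open import Relation.Nullary using (¬_)
open import Function.Bundles using (_⇔_)

ℕ^ : ℕ → Set
ℕ^ n = Fin n → ℕ

_≈_ : ∀ {n} → ℕ^ n → ℕ^ n → Set
x ≈ y = ∀ l → x l ≡ y l

_≤ᵖ_ : ∀ {n} → ℕ^ n → ℕ^ n → Set
x ≤ᵖ y = ∀ l → x l ≤ y l

_+ᵖ_ : ∀ {n} → ℕ^ n → ℕ^ n → ℕ^ n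
(x +ᵖ y) l = x l + y l

sumFin : ∀ n → (Fin n → ℕ) → ℕ
sumFin zero    f = 0
sumFin (suc n) f = f zero + sumFin n (λ l → f (suc l))

∣_∣ : ∀ {k} → ℕ^ k → ℕ
∣_∣ {k} z = sumFin k z

e : ∀ {k} → Fin k → ℕ^ k
e zero    zero    = 1
e zero    (suc l) = 0
e (suc j) zero    = 0
e (suc j) (suc l) = e j l

φ : ∀ {d k} → (Fin k → ℕ^ d) → ℕ^ k → ℕ^ d
φ {d} {k} α z m = sumFin k (λ l → z l * α l m)

-- α_1,…,α_k is the minimal generating set of Γ = ⟨α_1,…,α_k⟩:
-- the only factorization of each α_j is the unit vector e_j
-- (equivalently: the α_j are nonzero, pairwise distinct and
-- none is a sum of other elements of Γ, i.e. they are the atoms).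
MinimalGenerators : ∀ {d k} → (Fin k → ℕ^ d) → Set
MinimalGenerators {d} {k} α = ∀ (j : Fin k) (z : ℕ^ k) → φ α z ≈ α j → z ≈ e j

_∈Γ_ : ∀ {d k} → ℕ^ d → (Fin k → ℕ^ d) → Set
γ ∈Γ α = ∃ λ z → φ α z ≈ γ

_∈Z[_,_] : ∀ {d k} → ℕ^ k → (Fin k → ℕ^ d) → ℕ^ d → Set
z ∈Z[ α , γ ] = φ α z ≈ γ

In-αᵢ+Γ : ∀ {d k} → (Fin k → ℕ^ d) → Fin k → ℕ^ d → Set
In-αᵢ+Γ α i γ = Σ (ℕ^ _) λ β → (β ∈Γ α) × (γ ≈ (α i +ᵖ β))

gcdᶻ : ∀ {k} → ℕ^ k → ℕ^ k → ℕ^ k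
gcdᶻ z w l = z l ⊓ w l

_-ᵖ_ : ∀ {k} → ℕ^ k → ℕ^ k → ℕ^ k
(z -ᵖ w) l = z l ∸ w l

dist : ∀ {k} → ℕ^ k → ℕ^ k → ℕ
dist z w = ∣ z -ᵖ gcdᶻ z w ∣ ⊔ ∣ w -ᵖ gcdᶻ z w ∣

data ℕ∞ : Set where
  fin : ℕ → ℕ∞
  ∞   : ℕ∞

data _≤∞_ : ℕ∞ → ℕ∞ → Set where
  fin≤fin : ∀ {m n} → m ≤ n → fin m ≤∞ fin n
  _≤∞∞    : ∀ x → x ≤∞ ∞

_≤ℕ∞_ : ℕ → ℕ∞ → Set
m ≤ℕ∞ x = fin m ≤∞ x

TiCond : ∀ {d k} → (Fin k → ℕ^ d) → Fin k → ℕ^ d → ℕ∞ → Set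
TiCond α i γ N =
  ∀ z → z ∈Z[ α , γ ] → ∃ λ w → w ∈Z[ α , γ ] × (0 < w i) × (dist z w ≤ℕ∞ N)

IsTi : ∀ {d k} → (Fin k → ℕ^ d) → Fin k → ℕ^ d → ℕ∞ → Set
IsTi α i γ x = TiCond α i γ x × (∀ N → TiCond α i γ N → x ≤∞ N)

IsSup : (ℕ∞ → Set) → ℕ∞ → Set
IsSup P s = (∀ x → P x → x ≤∞ s) × (∀ u → (∀ x → P x → x ≤∞ u) → s ≤∞ u)

IsMinimalFact : ∀ {d k} → (Fin k → ℕ^ d) → Fin k → ℕ^ k → Set
IsMinimalFact α i x =
  In-αᵢ+Γ α i (φ α x) ×
  (∀ y → In-αᵢ+Γ α i (φ α y) → y ≤ᵖ x → y ≈ x)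

In-Mᵢ : ∀ {d k} → (Fin k → ℕ^ d) → Fin k → ℕ^ d → Set
In-Mᵢ α i γ = ∃ λ x → IsMinimalFact α i x × (φ α x ≈ γ)

TiValuesΓ : ∀ {d k} → (Fin k → ℕ^ d) → Fin k → ℕ∞ → Set
TiValuesΓ α i x = ∃ λ γ → In-αᵢ+Γ α i γ × IsTi α i γ x

TiValuesM : ∀ {d k} → (Fin k → ℕ^ d) → Fin k → ℕ∞ → Set
TiValuesM α i x = ∃ λ γ → In-Mᵢ α i γ × IsTi α i γ x

-- Since M_i ⊆ α_i + Γ, every upper bound of {t_i(γ) : γ ∈ α_i + Γ} bounds
-- {t_i(γ) : γ ∈ M_i}.  The converse is the heart of the proof: let u bound
-- t_i on M_i and γ ∈ α_i + Γ.  Every factorization z of γ lies above a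
-- minimal factorization x of α_i + Γ; t_i(φ(x)) ≤ u yields w' ∈ Z(φ(x)) with
-- w'_i > 0 and dist(x, w') ≤ u, and then w = w' + (z - x) ∈ Z(γ) has w_i > 0
-- and dist(z, w) = dist(x, w') ≤ u.  Hence u satisfies the defining condition
-- of t_i(γ), so t_i(γ) ≤ u.  Two sets with the same upper bounds have the same
-- supremum, which gives the theorem.
--
-- The argument is classical (minimal elements, least N), so it is carried out
-- in the double-negation monad; this is sound because the final conclusion
-- t_i(γ) ≤ u is decidable, and Z(γ) is finite (the atoms are nonzero), which
-- lets double negation commute with the quantifier over Z(γ).

module Submission where

open import Defs
open import Data.Nat using (ℕ; zero; suc; _+_; _*_; _∸_; _≤_; _<_; _⊓_; _⊔_; z≤n; s≤s; >-nonZero)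
open import Data.Nat.Properties
open import Data.Nat.Induction using (<-wellFounded)
open import Data.Fin using (Fin; zero; suc)
open import Data.Fin.Properties using (any?)
open import Data.Product using (∃; _×_; _,_; proj₁)
open import Data.Sum using (_⊎_; inj₁; inj₂)
open import Function using (_∘_; _on_)
open import Function.Bundles using (_⇔_; mk⇔)
open import Induction.WellFounded using (Acc; acc)
open import Level using (0ℓ)
open import Relation.Binary.Construct.On as On using ()
open import Relation.Binary.PropositionalEquality using (_≡_; refl; sym; trans; cong; cong₂; subst; module ≡-Reasoning)
open import Relation.Nullary using (¬_; Dec; yes; no; contradiction)
open import Relation.Nullary.Decidable using (decidable-stable; ¬¬-excluded-middle)
open import Relation.Nullary.Negation using (¬¬-Monad; ¬¬-map)
open import Effect.Monad using (RawMonad)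
open import Algebra.Properties.CommutativeSemigroup +-commutativeSemigroup using (interchange)

open RawMonad (¬¬-Monad {0ℓ}) using (pure; _>>=_)

¬¬-→ : ∀ {A B : Set} → (A → ¬ ¬ B) → ¬ ¬ (A → B)
¬¬-→ {A} f = ¬¬-excluded-middle {A = A} >>= λ
  { (yes a) → ¬¬-map (λ b _ → b) (f a)
  ; (no ¬a) → pure (λ a → contradiction a ¬a) }

¬¬-minimal : ∀ {A : Set} {_≺_ : A → A → Set} {P : A → Set} {a : A} → Acc _≺_ a → P a →
  ¬ ¬ (∃ λ m → P m × (∀ m' → m' ≺ m → ¬ P m'))
¬¬-minimal {_≺_ = _≺_} {P} {a} (acc smaller) pa =
  ¬¬-excluded-middle {A = ∃ λ m' → m' ≺ a × P m'} >>= λ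
  { (yes (m' , m'≺a , pm')) → ¬¬-minimal (smaller m'≺a) pm'
  ; (no none) → pure (a , pa , λ m' m'≺a pm' → none (m' , m'≺a , pm')) }

¬¬-shift-≤ : ∀ B (R : ℕ → Set) → (∀ h → h ≤ B → ¬ ¬ R h) → ¬ ¬ (∀ h → h ≤ B → R h)
¬¬-shift-≤ zero R f = ¬¬-map (λ { r .0 z≤n → r }) (f 0 z≤n)
¬¬-shift-≤ (suc B) R f =
  ¬¬-shift-≤ B R (λ h h≤B → f h (m≤n⇒m≤1+n h≤B)) >>= λ below →
  ¬¬-map (λ top h h≤1+B → extend below top h (m≤n⇒m<n∨m≡n h≤1+B)) (f (suc B) ≤-refl)
  where
  extend : (∀ h → h ≤ B → R h) → R (suc B) → ∀ h → h < suc B ⊎ h ≡ suc B → R h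
  extend below top h (inj₁ (s≤s h≤B)) = below h h≤B
  extend below top h (inj₂ refl)      = top

_◂_ : ∀ {k} → ℕ → ℕ^ k → ℕ^ (suc k)
(h ◂ t) zero    = h
(h ◂ t) (suc l) = t l

¬¬-shift-box : ∀ k B (P : ℕ^ k → Set) → (∀ {z z'} → z ≈ z' → P z → P z') →
  (∀ z → z ≤ᵖ (λ _ → B) → ¬ ¬ P z) → ¬ ¬ (∀ z → z ≤ᵖ (λ _ → B) → P z)
¬¬-shift-box zero B P resp f = ¬¬-map (λ p z _ → resp (λ ()) p) (f (λ ()) (λ ()))
¬¬-shift-box (suc k) B P resp f = ¬¬-map reassemble (¬¬-shift-≤ B Slice slice)
  where
  Slice : ℕ → Set
  Slice h = ∀ t → t ≤ᵖ (λ _ → B) → P (h ◂ t)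
  slice : ∀ h → h ≤ B → ¬ ¬ Slice h
  slice h h≤B = ¬¬-shift-box k B (P ∘ (h ◂_))
    (λ t≈t' → resp (λ { zero → refl ; (suc l) → t≈t' l }))
    (λ t t≤B → f (h ◂ t) (λ { zero → h≤B ; (suc l) → t≤B l }))
  reassemble : (∀ h → h ≤ B → Slice h) → ∀ z → z ≤ᵖ (λ _ → B) → P z
  reassemble g z z≤B =
    resp (λ { zero → refl ; (suc l) → refl }) (g (z zero) (z≤B zero) (z ∘ suc) (z≤B ∘ suc))

sumFin-cong : ∀ k {f g : Fin k → ℕ} → (∀ l → f l ≡ g l) → sumFin k f ≡ sumFin k g
sumFin-cong zero    f≡g = refl
sumFin-cong (suc k) f≡g = cong₂ _+_ (f≡g zero) (sumFin-cong k (f≡g ∘ suc))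

sumFin-+ : ∀ k (f g : Fin k → ℕ) → sumFin k (λ l → f l + g l) ≡ sumFin k f + sumFin k g
sumFin-+ zero    f g = refl
sumFin-+ (suc k) f g = begin
  (f zero + g zero) + sumFin k (λ l → f (suc l) + g (suc l))
    ≡⟨ cong ((f zero + g zero) +_) (sumFin-+ k (f ∘ suc) (g ∘ suc)) ⟩
  (f zero + g zero) + (sumFin k (f ∘ suc) + sumFin k (g ∘ suc))
    ≡⟨ interchange (f zero) (g zero) _ _ ⟩
  (f zero + sumFin k (f ∘ suc)) + (g zero + sumFin k (g ∘ suc)) ∎
  where open ≡-Reasoning

sumFin-mono : ∀ k {f g : Fin k → ℕ} → (∀ l → f l ≤ g l) → sumFin k f ≤ sumFin k g
sumFin-mono zero    f≤g = z≤n
sumFin-mono (suc k) f≤g = +-mono-≤ (f≤g zero) (sumFin-mono k (f≤g ∘ suc))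

sumFin-zero : ∀ k → sumFin k (λ _ → 0) ≡ 0
sumFin-zero zero    = refl
sumFin-zero (suc k) = sumFin-zero k

sumFin-term : ∀ k (f : Fin k → ℕ) j → f j ≤ sumFin k f
sumFin-term (suc k) f zero    = m≤m+n _ _
sumFin-term (suc k) f (suc j) = ≤-trans (sumFin-term k (f ∘ suc) j) (m≤n+m _ _)

sumFin-≡⇒≈ : ∀ k {f g : Fin k → ℕ} → (∀ l → f l ≤ g l) → sumFin k f ≡ sumFin k g →
  ∀ l → f l ≡ g l
sumFin-≡⇒≈ (suc k) {f} {g} f≤g sums≡ = pointwise
  where
  head≡ : f zero ≡ g zero
  head≡ with m≤n⇒m<n∨m≡n (f≤g zero)
  ... | inj₂ eq = eq
  ... | inj₁ lt = contradiction sums≡ (<⇒≢ (+-mono-<-≤ lt (sumFin-mono k (f≤g ∘ suc))))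
  tail≡ : sumFin k (f ∘ suc) ≡ sumFin k (g ∘ suc)
  tail≡ = +-cancelˡ-≡ (f zero) _ _ (trans sums≡ (cong (_+ sumFin k (g ∘ suc)) (sym head≡)))
  pointwise : ∀ l → f l ≡ g l
  pointwise zero    = head≡
  pointwise (suc l) = sumFin-≡⇒≈ k (f≤g ∘ suc) tail≡ l

≈-sym : ∀ {n} {x y : ℕ^ n} → x ≈ y → y ≈ x
≈-sym x≈y l = sym (x≈y l)

e-diag : ∀ {k} (j : Fin k) → e j j ≡ 1
e-diag zero    = refl
e-diag (suc j) = e-diag j

φ-e : ∀ {d k} (α : Fin k → ℕ^ d) (j : Fin k) → φ α (e j) ≈ α j
φ-e {k = suc k} α zero m rewrite sumFin-zero k = trans (+-identityʳ _) (+-identityʳ _)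
φ-e {k = suc k} α (suc j) m = φ-e (α ∘ suc) j m

module _ {d k : ℕ} (α : Fin k → ℕ^ d) where

  φ-cong : ∀ {z z' : ℕ^ k} → z ≈ z' → φ α z ≈ φ α z'
  φ-cong z≈z' m = sumFin-cong k (λ l → cong (_* α l m) (z≈z' l))

  φ-+ : ∀ (z w : ℕ^ k) → φ α (z +ᵖ w) ≈ (φ α z +ᵖ φ α w)
  φ-+ z w m = trans (sumFin-cong k (λ l → *-distribʳ-+ (α l m) (z l) (w l)))
                    (sumFin-+ k (λ l → z l * α l m) (λ l → w l * α l m))

dist-cong : ∀ {k} {z z' w : ℕ^ k} → z ≈ z' → dist z w ≡ dist z' w
dist-cong {k} {z} {z'} {w} z≈z' = cong₂ _⊔_
  (sumFin-cong k (λ l → cong₂ _∸_ (z≈z' l) (cong (_⊓ w l) (z≈z' l))))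
  (sumFin-cong k (λ l → cong (w l ∸_) (cong (_⊓ w l) (z≈z' l))))

-- gcd commutes with translation, so dist is translation invariant.
dist-translate : ∀ {k} (c x w : ℕ^ k) → dist (c +ᵖ x) (c +ᵖ w) ≡ dist x w
dist-translate {k} c x w = cong₂ _⊔_ (sumFin-cong k (cancel x)) (sumFin-cong k (cancel w))
  where
  cancel : (y : ℕ^ k) → ∀ l → (c l + y l) ∸ ((c l + x l) ⊓ (c l + w l)) ≡ y l ∸ (x l ⊓ w l)
  cancel y l = trans (cong (c l + y l ∸_) (sym (+-distribˡ-⊓ (c l) (x l) (w l))))
                     ([m+n]∸[m+o]≡n∸o (c l) (y l) (x l ⊓ w l))

Minimal : ∀ {k} → (ℕ^ k → Set) → ℕ^ k → Set
Minimal S x = S x × (∀ y → S y → y ≤ᵖ x → y ≈ x)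

minimal-below : ∀ {k} (S : ℕ^ k → Set) z → S z → ¬ ¬ (∃ λ x → Minimal S x × x ≤ᵖ z)
minimal-below {k} S z z∈S =
  ¬¬-map minimal (¬¬-minimal {_≺_ = _<_ on ∣_∣} {P = Below}
                   (On.wellFounded ∣_∣ <-wellFounded z) (z∈S , λ _ → ≤-refl))
  where
  Below : ℕ^ k → Set
  Below y = S y × y ≤ᵖ z
  minimal : (∃ λ x → Below x × (∀ y → ∣ y ∣ < ∣ x ∣ → ¬ Below y)) →
            ∃ λ x → Minimal S x × x ≤ᵖ z
  minimal (x , (x∈S , x≤z) , none-smaller) = x , (x∈S , below-x-is-x) , x≤z
    where
    below-x-is-x : ∀ y → S y → y ≤ᵖ x → y ≈ x
    below-x-is-x y y∈S y≤x = sumFin-≡⇒≈ k y≤x (≤-antisym (sumFin-mono k y≤x)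
      (≮⇒≥ λ y<x → none-smaller y y<x (y∈S , λ l → ≤-trans (y≤x l) (x≤z l))))

≤∞-trans : ∀ {x y z} → x ≤∞ y → y ≤∞ z → x ≤∞ z
≤∞-trans (fin≤fin m≤n) (fin≤fin n≤o) = fin≤fin (≤-trans m≤n n≤o)
≤∞-trans x≤y           (_ ≤∞∞)       = _ ≤∞∞

-- Bounds t ≤ n are decidable, which makes them stable under ¬¬.
_≤fin?_ : ∀ t n → Dec (t ≤∞ fin n)
fin m ≤fin? n with m ≤? n
... | yes m≤n = yes (fin≤fin m≤n)
... | no  m≰n = no λ { (fin≤fin m≤n) → m≰n m≤n }
∞     ≤fin? n = no λ ()

UpperBound : (ℕ∞ → Set) → ℕ∞ → Set
UpperBound P u = ∀ t → P t → t ≤∞ u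

IsSup-transfer : ∀ {P Q : ℕ∞ → Set} {s} →
  (∀ u → UpperBound P u → UpperBound Q u) → (∀ u → UpperBound Q u → UpperBound P u) →
  IsSup P s → IsSup Q s
IsSup-transfer P⇒Q Q⇒P (s-bound , s-least) = P⇒Q _ s-bound , λ u → s-least u ∘ Q⇒P u

module Factorizations {d k : ℕ} (α : Fin k → ℕ^ d) where

  -- Atoms are nonzero: otherwise the zero vector would be a factorization of α_j.
  atom-nonzero : MinimalGenerators α → ∀ j → ∃ λ m → 0 < α j m
  atom-nonzero mg j with any? (λ m → 0 <? α j m)
  ... | yes positive = positive
  ... | no  none     = contradiction (trans (mg j (λ _ → 0) zero-factors j) (e-diag j)) λ ()
    where
    zero-factors : φ α (λ _ → 0) ≈ α j
    zero-factors m = trans (sumFin-zero k) (sym (n≤0⇒n≡0 (≮⇒≥ λ pos → none (m , pos))))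

  -- Z(γ) is finite: every coordinate of a factorization of γ is at most Σ γ.
  factorization-bounded : MinimalGenerators α → ∀ {γ} z → z ∈Z[ α , γ ] →
    z ≤ᵖ (λ _ → sumFin d γ)
  factorization-bounded mg {γ} z z∈Zγ l with atom-nonzero mg l
  ... | m , pos = begin
    z l          ≤⟨ m≤m*n (z l) (α l m) {{>-nonZero pos}} ⟩
    z l * α l m  ≤⟨ sumFin-term k (λ l' → z l' * α l' m) l ⟩
    φ α z m      ≡⟨ z∈Zγ m ⟩
    γ m          ≤⟨ sumFin-term d γ m ⟩
    sumFin d γ   ∎
    where open ≤-Reasoning

  In-αᵢ+Γ-resp : ∀ {i γ γ'} → γ ≈ γ' → In-αᵢ+Γ α i γ → In-αᵢ+Γ α i γ'
  In-αᵢ+Γ-resp γ≈γ' (β , β∈Γ , γ≈αᵢ+β) = β , β∈Γ , λ m → trans (sym (γ≈γ' m)) (γ≈αᵢ+β m)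

  M-values⊆Γ-values : ∀ i t → TiValuesM α i t → TiValuesΓ α i t
  M-values⊆Γ-values i t (γ , (x , (x∈ , _) , φx≈γ) , t-isTi) = γ , In-αᵢ+Γ-resp φx≈γ x∈ , t-isTi

  module _ (i : Fin k) where

    Near : ℕ^ d → ℕ∞ → ℕ^ k → Set
    Near γ N z = ∃ λ w → w ∈Z[ α , γ ] × (0 < w i) × (dist z w ≤ℕ∞ N)

    TiCond-mono : ∀ {γ N N'} → N ≤∞ N' → TiCond α i γ N → TiCond α i γ N'
    TiCond-mono N≤N' cond z z∈Zγ with cond z z∈Zγ
    ... | w , w∈Zγ , w-pos , close = w , w∈Zγ , w-pos , ≤∞-trans close N≤N'

    -- Invariance under pointwise equality, needed to shift ¬¬ over Z(γ).
    Near-resp : ∀ {γ N z z'} → z ≈ z' →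
      (z ∈Z[ α , γ ] → Near γ N z) → (z' ∈Z[ α , γ ] → Near γ N z')
    Near-resp {N = N} z≈z' near z'∈Zγ with near (λ m → trans (φ-cong α z≈z' m) (z'∈Zγ m))
    ... | w , w∈Zγ , w-pos , close = w , w∈Zγ , w-pos , subst (_≤ℕ∞ N) (dist-cong z≈z') close

    -- t_i(γ) exists for γ ∈ α_i + Γ: it is the least N satisfying the
    -- condition, or ∞, which always satisfies it since e_i + v ∈ Z(γ) for
    -- every v ∈ Z(γ - α_i).
    ti-exists : ∀ {γ} → In-αᵢ+Γ α i γ → ¬ ¬ (∃ λ t → IsTi α i γ t)
    ti-exists {γ} (β , (v , v∈Zβ) , γ≈αᵢ+β) =
      ¬¬-excluded-middle {A = ∃ λ N → TiCond α i γ (fin N)} >>= λ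
        { (yes (N , cond)) → ¬¬-map least-finite (¬¬-minimal (<-wellFounded N) cond)
        ; (no none) → pure (∞ , cond∞ , λ { (fin N) cond → contradiction (N , cond) none
                                          ; ∞ _ → ∞ ≤∞∞ }) }
      where
      w∈Zγ : (e i +ᵖ v) ∈Z[ α , γ ]
      w∈Zγ m = trans (φ-+ α (e i) v m) (trans (cong₂ _+_ (φ-e α i m) (v∈Zβ m)) (sym (γ≈αᵢ+β m)))
      cond∞ : TiCond α i γ ∞
      cond∞ z _ = e i +ᵖ v , w∈Zγ , ≤-trans (≤-reflexive (sym (e-diag i))) (m≤m+n _ _) , _ ≤∞∞
      least-finite : (∃ λ m → TiCond α i γ (fin m) × (∀ m' → m' < m → ¬ TiCond α i γ (fin m'))) →
                     ∃ λ t → IsTi α i γ t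
      least-finite (m , cond , none-smaller) = fin m , cond , λ
        { (fin N) condN → fin≤fin (≮⇒≥ λ N<m → none-smaller N N<m condN)
        ; ∞ _ → fin m ≤∞∞ }

    -- Lifting along x ≤ z: if w' ∈ Z(φ(x)) is near x, then w' + (z - x) is
    -- a factorization of φ(z) that is equally near z.
    near-lift : ∀ {γ N} z x → z ∈Z[ α , γ ] → x ≤ᵖ z → Near (φ α x) N x → Near γ N z
    near-lift {γ} {N} z x z∈Zγ x≤z (w' , w'∈Zφx , w'-pos , close) =
      c +ᵖ w' , lifted∈Zγ , ≤-trans w'-pos (m≤n+m _ _) , subst (_≤ℕ∞ N) (sym same-dist) close
      where
      c : ℕ^ k
      c = z -ᵖ x
      c+x≈z : (c +ᵖ x) ≈ z
      c+x≈z l = m∸n+n≡m (x≤z l)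
      lifted∈Zγ : (c +ᵖ w') ∈Z[ α , γ ]
      lifted∈Zγ m = begin
        φ α (c +ᵖ w') m     ≡⟨ φ-+ α c w' m ⟩
        φ α c m + φ α w' m  ≡⟨ cong (φ α c m +_) (w'∈Zφx m) ⟩
        φ α c m + φ α x m   ≡⟨ sym (φ-+ α c x m) ⟩
        φ α (c +ᵖ x) m      ≡⟨ φ-cong α c+x≈z m ⟩
        φ α z m             ≡⟨ z∈Zγ m ⟩
        γ m                 ∎
        where open ≡-Reasoning
      same-dist : dist z (c +ᵖ w') ≡ dist x w'
      same-dist = trans (dist-cong (≈-sym c+x≈z)) (dist-translate c x w')

    -- Each z ∈ Z(γ) lies above a minimal x, and the witness for
    -- x lifts to z; the conclusion t_i(γ) ≤ n is decidable, so the classical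
    -- reasoning may be discharged.
    bounds-M⇒bounds-Γ : MinimalGenerators α →
      ∀ u → UpperBound (TiValuesM α i) u → UpperBound (TiValuesΓ α i) u
    bounds-M⇒bounds-Γ mg ∞       _      t _ = t ≤∞∞
    bounds-M⇒bounds-Γ mg (fin n) boundM t (γ , γ∈αᵢ+Γ , (_ , t-least)) =
      decidable-stable (t ≤fin? n) (¬¬-map (t-least (fin n)) condition)
      where
      near-each : ∀ z → z ∈Z[ α , γ ] → ¬ ¬ Near γ (fin n) z
      near-each z z∈Zγ =
        minimal-below _ z (In-αᵢ+Γ-resp (≈-sym z∈Zγ) γ∈αᵢ+Γ) >>= λ (x , x-minimal , x≤z) →
        ¬¬-map (λ (tx , tx-isTi) →
          let tx≤n = boundM tx (φ α x , (x , x-minimal , λ _ → refl) , tx-isTi)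
          in  near-lift z x z∈Zγ x≤z (TiCond-mono tx≤n (proj₁ tx-isTi) x (λ _ → refl)))
          (ti-exists (proj₁ x-minimal))
      condition : ¬ ¬ TiCond α i γ (fin n)
      condition = ¬¬-map (λ near z z∈Zγ → near z (factorization-bounded mg z z∈Zγ) z∈Zγ)
        (¬¬-shift-box k (sumFin d γ) (λ z → z ∈Z[ α , γ ] → Near γ (fin n) z) Near-resp
          (λ z _ → ¬¬-→ (near-each z)))

    bounds-Γ⇒bounds-M : ∀ u → UpperBound (TiValuesΓ α i) u → UpperBound (TiValuesM α i) u
    bounds-Γ⇒bounds-M u boundΓ t = boundΓ t ∘ M-values⊆Γ-values i t

theorem5p2 : (d k : ℕ) (α : Fin k → ℕ^ d) → MinimalGenerators α →
    (i : Fin k) (s : ℕ∞) →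
    IsSup (TiValuesΓ α i) s ⇔ IsSup (TiValuesM α i) s
theorem5p2 d k α mg i s =
  mk⇔ (IsSup-transfer (bounds-Γ⇒bounds-M i) (bounds-M⇒bounds-Γ i mg))
      (IsSup-transfer (bounds-M⇒bounds-Γ i mg) (bounds-Γ⇒bounds-M i))
  where open Factorizations α
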